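{- There is an absolute constant $C$ such that for every finite point set $P\subset\mathbb{R}^2$ with distinct $x$-coordinates and distinct $y$-coordinates, with $m=|P|$, we have $\mathsf{zRects}(P)\ge \mathsf{Funnel}(P)/2-C\,m$.
   Context: For a point $p$, $p.x,p.y$ are its coordinates. A z-rectangle of $P$ is a tuple $(p,q,r,s)\in P^4$ with $q.x<p.x<r.x<s.x$, $r.y<q.y<s.y<p.y$, and $P\cap([q.x,s.x]\times[r.y,p.y])=\{p,q,r,s\}$; $\mathsf{zRects}(P)$ is their number. Mixing value: for disjoint finite $L,R\subset\mathbb{R}$, $\mathrm{mix}(L,R)\in\{\mathtt{L},\mathtt{R}\}^*$ lists $L\cup R$ in increasing order writing $\mathtt{L}$ for elements of $L$ and $\mathtt{R}$ for those of $R$; $\mathrm{blocks}(s)$ is $0$ for the empty word, else the number of maximal runs of equal letters; $\mathrm{mixValue}(L,R)=\mathrm{blocks}(\mathrm{mix}(L,R))$. $\mathrm{rect}(p,q)$ is the smallest closed axis-aligned rectangle containing $p,q$. For $p\in P$: $F_L(P,p)=\{q\in P: q.y<p.y,\ q.x<p.x,\ P\cap\mathrm{rect}(p,q)=\{p,q\}\}$, $F_R(P,p)$ the same with $q.x>p.x$; $f(P,p)=\mathrm{mixValue}(F_L(P,p).y,F_R(P,p).y)$ where $S.y=\{q.y:q\in S\}$; $\mathsf{Funnel}(P)=\sum_{p\in P}f(P,p)$. -}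

module Defs where

open import Level using (0ℓ)
open import Relation.Binary.Bundles using (StrictTotalOrder)
open import Relation.Binary.Definitions using (Tri; tri<; tri≈; tri>)
open import Relation.Nullary using (¬_)
open import Relation.Nullary.Decidable using (⌊_⌋)
open import Data.Bool using (Bool; true; false; _∧_; _∨_; not; if_then_else_)
open import Data.Nat using (ℕ; zero; suc; _+_)
open import Data.Fin using (Fin) renaming (_≟_ to _≟ᶠ_)
open import Data.Product using (_×_; _,_; proj₁; proj₂)
open import Data.List using (List; []; _∷_; length; lookup; map; allFin; concatMap)
open import Data.Nat.ListAction using (sum)
open import Data.List.Relation.Unary.AllPairs using (AllPairs)

-- Sides of a point relative to p (letters L and R of the mixing word)
data Side : Set where
  sideL sideR : Side

sameSide : Side → Side → Bool
sameSide sideL sideL = true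
sameSide sideR sideR = true
sameSide _     _     = false

changes : Side → List Side → ℕ
changes a []       = 0
changes a (b ∷ xs) = (if sameSide a b then 0 else 1) + changes b xs

blocks : List Side → ℕ
blocks []       = 0
blocks (a ∷ xs) = suc (changes a xs)

countFin : (n : ℕ) → (Fin n → Bool) → ℕ
countFin n f = sum (map (λ i → if f i then 1 else 0) (allFin n))

sumFin : (n : ℕ) → (Fin n → ℕ) → ℕ
sumFin n g = sum (map g (allFin n))

-- Coordinates live in an arbitrary (decidable) strict total order,
-- e.g. the reals; only the order of coordinates matters.
module _ (O : StrictTotalOrder 0ℓ 0ℓ 0ℓ) where
  open StrictTotalOrder O using (_<_; _≈_; compare) renaming (Carrier to A)

  Point : Set
  Point = A × A

  private
    isLt : ∀ {a b} → Tri (a < b) (a ≈ b) (b < a) → Bool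
    isLt (tri< _ _ _) = true
    isLt (tri≈ _ _ _) = false
    isLt (tri> _ _ _) = false

  ltb : A → A → Bool
  ltb a b = isLt (compare a b)

  leb : A → A → Bool
  leb a b = not (ltb b a)

  DistinctCoords : List Point → Set
  DistinctCoords P =
    AllPairs (λ p q → ¬ (proj₁ p ≈ proj₁ q) × ¬ (proj₂ p ≈ proj₂ q)) P

  module _ (P : List Point) where
    private
      m = length P
      Idx = Fin m
      pt : Idx → Point
      pt i = lookup P i
      X : Idx → A
      X i = proj₁ (pt i)
      Y : Idx → A
      Y i = proj₂ (pt i)
      eqI : Idx → Idx → Bool
      eqI i j = ⌊ i ≟ᶠ j ⌋
      allIdx : (Idx → Bool) → Bool
      allIdx f = Data.List.foldr (λ i b → f i ∧ b) true (allFin m)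

    inBox : A → A → A → A → Idx → Bool
    inBox x₁ x₂ y₁ y₂ t = leb x₁ (X t) ∧ leb (X t) x₂ ∧ leb y₁ (Y t) ∧ leb (Y t) y₂

    isZRect : Idx → Idx → Idx → Idx → Bool
    isZRect p q r s =
      ltb (X q) (X p) ∧ ltb (X p) (X r) ∧ ltb (X r) (X s) ∧
      ltb (Y r) (Y q) ∧ ltb (Y q) (Y s) ∧ ltb (Y s) (Y p) ∧
      allIdx (λ t → not (inBox (X q) (X s) (Y r) (Y p) t)
                    ∨ eqI t p ∨ eqI t q ∨ eqI t r ∨ eqI t s)

    zRects : ℕ
    zRects = sumFin m λ p → sumFin m λ q → sumFin m λ r → countFin m λ s → isZRect p q r s

    between : A → A → A → Bool
    between a b c = (leb a c ∧ leb c b) ∨ (leb b c ∧ leb c a)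

    inRect : Idx → Idx → Idx → Bool
    inRect p q t = between (X p) (X q) (X t) ∧ between (Y p) (Y q) (Y t)

    below-empty : Idx → Idx → Bool
    below-empty p q = ltb (Y q) (Y p) ∧ allIdx (λ t → not (inRect p q t) ∨ eqI t p ∨ eqI t q)

    inFL : Idx → Idx → Bool
    inFL p q = below-empty p q ∧ ltb (X q) (X p)

    inFR : Idx → Idx → Bool
    inFR p q = below-empty p q ∧ ltb (X p) (X q)

    labelled : Idx → List (A × Side)
    labelled p = concatMap (λ q → (if inFL p q then (Y q , sideL) ∷ [] else [])
                                  Data.List.++ (if inFR p q then (Y q , sideR) ∷ [] else []))
                           (allFin m)

    insertY : A × Side → List (A × Side) → List (A × Side)
    insertY e [] = e ∷ []
    insertY e (h ∷ t) = if ltb (proj₁ h) (proj₁ e) then h ∷ insertY e t else e ∷ h ∷ t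

    sortY : List (A × Side) → List (A × Side)
    sortY = Data.List.foldr insertY []

    mix : Idx → List Side
    mix p = map proj₂ (sortY (labelled p))

    f : Idx → ℕ
    f p = blocks (mix p)

    Funnel : ℕ
    Funnel = sumFin m f

-- Fix an apex p and list its lower neighbours F_L(P,p) ∪ F_R(P,p) by increasing height, so that
-- mix(F_L(P,p).y, F_R(P,p).y) is the word of their sides. Whenever a right neighbour r is
-- immediately followed by a left neighbour q and some right neighbour comes later, the first such s
-- makes (p,q,r,s) a z-rectangle: a further point t of P in [q.x,s.x] × [r.y,p.y] would, through the
-- highest point of P ∩ rect(p,t) below p, yield a lower neighbour of p on the side of t with height
-- strictly between r.y and q.y (left) or between r.y and s.y (right), contradicting the choice of
-- r, q, s. Each such occurrence pays for its R→L change and the next L→R change, and different q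
-- give different z-rectangles, so f(P,p) ≤ 2·#{z-rectangles with apex p} + 3. Summing over p gives
-- Funnel(P) ≤ 2·zRects(P) + 3m.

module Submission where

open import Defs
open import Level using (0ℓ)
open import Relation.Binary.Bundles using (StrictTotalOrder)
open import Relation.Binary.Definitions using (tri<; tri≈; tri>)
import Relation.Binary.Construct.StrictToNonStrict as StrictToNonStrict
import Relation.Binary.Properties.StrictTotalOrder as StrictTotalOrderProperties
open import Relation.Nullary using (¬_; Dec; yes; no; does)
import Relation.Nullary.Decidable as Dec
open import Relation.Nullary.Decidable using (⌊_⌋; toWitness; fromWitness; _×-dec_; T?)
open import Relation.Unary using (Decidable)
open import Data.Bool using (Bool; true; false; T; _∧_; _∨_; not; if_then_else_)
open import Data.Bool.Properties using (T-∧; T-∨; T-≡)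
open import Data.Empty using (⊥; ⊥-elim)
open import Data.Fin using (Fin; zero; suc; _≟_)
open import Data.List using (List; []; _∷_; _++_; foldr; map; filter; allFin; length; lookup; concatMap)
open import Data.List.Properties using (map-∘; length-tabulate)
open import Data.List.Relation.Unary.All as All using (All; []; _∷_)
open import Data.List.Relation.Unary.All.Properties using (all-filter)
open import Data.List.Relation.Unary.Any using (here; there)
open import Data.List.Relation.Unary.AllPairs using (AllPairs; []; _∷_)
open import Data.List.Membership.Propositional using (_∈_)
open import Data.List.Membership.Propositional.Properties using (∈-allFin; ∈-lookup; ∈-filter⁺; ∈-filter⁻)
open import Data.List.Relation.Binary.Permutation.Propositional
  using (_↭_; ↭-refl; ↭-prep; ↭-swap; ↭-trans; ↭-sym)
open import Data.List.Relation.Binary.Permutation.Propositional.Properties using (All-resp-↭; ∈-resp-↭; map⁺)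
import Data.List.Extrema
open import Data.Product using (Σ; _×_; _,_; proj₁; proj₂; uncurry; ∃-syntax; Σ-syntax)
open import Data.Product.Function.NonDependent.Propositional using (_×-⇔_)
open import Data.Sum using (_⊎_; inj₁; inj₂; [_,_]′)
open import Data.Sum.Function.Propositional using (_⊎-⇔_)
open import Function using (id; _∘_; _⇔_; mk⇔; Equivalence)
open import Function.Construct.Composition using (_⇔-∘_)
open import Relation.Binary.PropositionalEquality
  using (_≡_; _≢_; refl; sym; trans; cong; cong₂; subst; ≢-sym; module ≡-Reasoning)

open Equivalence using (to; from)

T-∧-⇔ : ∀ {x y} {A B : Set} → T x ⇔ A → T y ⇔ B → T (x ∧ y) ⇔ (A × B)
T-∧-⇔ x⇔A y⇔B = (x⇔A ×-⇔ y⇔B) ⇔-∘ T-∧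

T-∨-⇔ : ∀ {x y} {A B : Set} → T x ⇔ A → T y ⇔ B → T (x ∨ y) ⇔ (A ⊎ B)
T-∨-⇔ x⇔A y⇔B = (x⇔A ⊎-⇔ y⇔B) ⇔-∘ T-∨

T-not-∨-⇔ : ∀ {x y} {A B : Set} → T x ⇔ A → T y ⇔ B → T (not x ∨ y) ⇔ (A → B)
T-not-∨-⇔ {true}  x⇔A y⇔B = mk⇔ (λ y _ → to y⇔B y) (λ A→B → from y⇔B (A→B (to x⇔A _)))
T-not-∨-⇔ {false} x⇔A y⇔B = mk⇔ (λ _ a → ⊥-elim (from x⇔A a)) _

T-foldr-∧-⇔ : ∀ {I : Set} {g : I → Bool} {B : I → Set} → (∀ i → T (g i) ⇔ B i) →
              ∀ is → T (foldr (λ i b → g i ∧ b) true is) ⇔ All B is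
T-foldr-∧-⇔ g⇔B []       = mk⇔ (λ _ → []) _
T-foldr-∧-⇔ g⇔B (i ∷ is) =
  mk⇔ (uncurry _∷_) All.uncons ⇔-∘ T-∧-⇔ (g⇔B i) (T-foldr-∧-⇔ g⇔B is)

T-allFin-⇔ : ∀ {n} {g : Fin n → Bool} {B : Fin n → Set} → (∀ i → T (g i) ⇔ B i) →
             T (foldr (λ i b → g i ∧ b) true (allFin n)) ⇔ (∀ i → B i)
T-allFin-⇔ g⇔B =
  mk⇔ (λ all i → All.lookup all (∈-allFin i)) (λ all → All.tabulate λ {i} _ → all i)
  ⇔-∘ T-foldr-∧-⇔ g⇔B _

T-≟ : ∀ {n} {i j : Fin n} → T ⌊ i ≟ j ⌋ ⇔ (i ≡ j)
T-≟ = mk⇔ toWitness fromWitness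

module Word {I : Set} (side : I → Side) where

  data FirstRight : List I → I → Set where
    here  : ∀ {s xs} → side s ≡ sideR → FirstRight (s ∷ xs) s
    there : ∀ {x xs s} → side x ≡ sideL → FirstRight xs s → FirstRight (x ∷ xs) s

  data ZPattern : List I → I → I → I → Set where
    here  : ∀ {r q ys s} → side r ≡ sideR → side q ≡ sideL → FirstRight ys s →
            ZPattern (r ∷ q ∷ ys) r q s
    there : ∀ {x xs r q s} → ZPattern xs r q s → ZPattern (x ∷ xs) r q s

  firstRight? : ∀ xs → All (λ x → side x ≡ sideL) xs ⊎ ∃[ s ] FirstRight xs s
  firstRight? [] = inj₁ []
  firstRight? (x ∷ xs) with side x in sx | firstRight? xs
  ... | sideR | _              = inj₂ (x , here sx)
  ... | sideL | inj₁ allLeft   = inj₁ (sx ∷ allLeft)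
  ... | sideL | inj₂ (s , fr)  = inj₂ (s , there sx fr)

  firstRight-side : ∀ {ys s} → FirstRight ys s → side s ≡ sideR
  firstRight-side (here ss)    = ss
  firstRight-side (there _ fr) = firstRight-side fr

  firstRight-∈ : ∀ {ys s} → FirstRight ys s → s ∈ ys
  firstRight-∈ (here _)     = here refl
  firstRight-∈ (there _ fr) = there (firstRight-∈ fr)

  zpattern-∈ : ∀ {xs r q s} → ZPattern xs r q s → r ∈ xs × q ∈ xs × s ∈ xs
  zpattern-∈ (here _ _ fr) = here refl , there (here refl) , there (there (firstRight-∈ fr))
  zpattern-∈ (there zp) with zpattern-∈ zp
  ... | r∈ , q∈ , s∈ = there r∈ , there q∈ , there s∈

  zpattern-sides : ∀ {xs r q s} → ZPattern xs r q s →
                   side r ≡ sideR × side q ≡ sideL × side s ≡ sideR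
  zpattern-sides (here sr sq fr) = sr , sq , firstRight-side fr
  zpattern-sides (there zp)      = zpattern-sides zp

  changes-allLeft : ∀ {xs} → All (λ x → side x ≡ sideL) xs → changes sideL (map side xs) ≡ 0
  changes-allLeft []              = refl
  changes-allLeft {x ∷ _} (sx ∷ allLeft) rewrite sx = changes-allLeft allLeft

module Order (O : StrictTotalOrder 0ℓ 0ℓ 0ℓ) where
  open StrictTotalOrder O public
    using (_<_; _≈_; compare; irrefl; asym; _<?_; module Eq) renaming (Carrier to A; trans to <-trans)
  open StrictTotalOrder O using (<-respʳ-≈)
  open StrictTotalOrderProperties O public
    using (_≤_; totalOrder)
    renaming (refl to ≤-refl; trans to ≤-trans; antisym to ≤-antisym; total to ≤-total)
  open StrictToNonStrict _≈_ _<_ public using (<⇒≤)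

  <-≤-trans : ∀ {a b c} → a < b → b ≤ c → a < c
  <-≤-trans = StrictToNonStrict.<-≤-trans _≈_ _<_ <-trans <-respʳ-≈

  <⇒≱ : ∀ {a b} → a < b → ¬ b ≤ a
  <⇒≱ a<b b≤a = irrefl Eq.refl (<-≤-trans a<b b≤a)

  ≮⇒≥ : ∀ {a b} → ¬ a < b → b ≤ a
  ≮⇒≥ {a} {b} a≮b with compare a b
  ... | tri< a<b _ _ = ⊥-elim (a≮b a<b)
  ... | tri≈ _ a≈b _ = inj₂ (Eq.sym a≈b)
  ... | tri> _ _ b<a = inj₁ b<a

  ≤∧≉⇒< : ∀ {a b} → a ≤ b → ¬ a ≈ b → a < b
  ≤∧≉⇒< (inj₁ a<b) _   = a<b
  ≤∧≉⇒< (inj₂ a≈b) a≉b = ⊥-elim (a≉b a≈b)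

  T-ltb : ∀ {a b} → T (ltb O a b) ⇔ (a < b)
  T-ltb {a} {b} with compare a b
  ... | tri< a<b _ _ = mk⇔ (λ _ → a<b) _
  ... | tri≈ a≮b _ _ = mk⇔ (λ ()) a≮b
  ... | tri> a≮b _ _ = mk⇔ (λ ()) a≮b

  T-leb : ∀ {a b} → T (leb O a b) ⇔ (a ≤ b)
  T-leb {a} {b} with compare b a
  ... | tri< b<a _ _ = mk⇔ (λ ()) (<⇒≱ b<a)
  ... | tri≈ _ b≈a _ = mk⇔ (λ _ → inj₂ (Eq.sym b≈a)) _
  ... | tri> _ _ a<b = mk⇔ (λ _ → inj₁ a<b) _

  Between : A → A → A → Set
  Between a b c = (a ≤ c × c ≤ b) ⊎ (b ≤ c × c ≤ a)

  Between-end : ∀ a b → Between a b b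
  Between-end a b with ≤-total a b
  ... | inj₁ a≤b = inj₁ (a≤b , ≤-refl)
  ... | inj₂ b≤a = inj₂ (≤-refl , b≤a)

  Between-≤ : ∀ {a b c} → a ≤ b → Between a b c → a ≤ c × c ≤ b
  Between-≤ a≤b (inj₁ a≤c≤b)       = a≤c≤b
  Between-≤ a≤b (inj₂ (b≤c , c≤a)) = ≤-trans a≤b b≤c , ≤-trans c≤a a≤b

  Between-≥ : ∀ {a b c} → b ≤ a → Between a b c → b ≤ c × c ≤ a
  Between-≥ b≤a (inj₁ (a≤c , c≤b)) = ≤-trans b≤a a≤c , ≤-trans c≤b b≤a
  Between-≥ b≤a (inj₂ b≤c≤a)       = b≤c≤a

  Between-trans : ∀ {a b c d} → Between a b c → Between a c d → Between a b d
  Between-trans (inj₁ (a≤c , c≤b)) c∣d with Between-≤ a≤c c∣d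
  ... | a≤d , d≤c = inj₁ (a≤d , ≤-trans d≤c c≤b)
  Between-trans (inj₂ (b≤c , c≤a)) c∣d with Between-≥ c≤a c∣d
  ... | c≤d , d≤a = inj₂ (≤-trans b≤c c≤d , d≤a)

  Between-antisym : ∀ {a b c} → Between a b c → Between a c b → b ≈ c
  Between-antisym (inj₁ (a≤c , c≤b)) c∣b = ≤-antisym (proj₂ (Between-≤ a≤c c∣b)) c≤b
  Between-antisym (inj₂ (b≤c , c≤a)) c∣b = ≤-antisym b≤c (proj₁ (Between-≥ c≤a c∣b))

  key<⇒≢ : ∀ {I : Set} (key : I → A) {i j} → key i < key j → i ≢ j
  key<⇒≢ key ki<kj refl = irrefl Eq.refl ki<kj

  module _ {I : Set} (key : I → A) where

    insertOn : I → List I → List I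
    insertOn e []      = e ∷ []
    insertOn e (h ∷ t) = if ltb O (key h) (key e) then h ∷ insertOn e t else e ∷ h ∷ t

    sortOn : List I → List I
    sortOn = foldr insertOn []

    Sorted : List I → Set
    Sorted = AllPairs (λ a b → key a ≤ key b)

    insertOn-↭ : ∀ e t → insertOn e t ↭ e ∷ t
    insertOn-↭ e []      = ↭-refl
    insertOn-↭ e (h ∷ t) with ltb O (key h) (key e)
    ... | true  = ↭-trans (↭-prep h (insertOn-↭ e t)) (↭-swap h e ↭-refl)
    ... | false = ↭-refl

    sortOn-↭ : ∀ xs → sortOn xs ↭ xs
    sortOn-↭ []       = ↭-refl
    sortOn-↭ (x ∷ xs) = ↭-trans (insertOn-↭ x (sortOn xs)) (↭-prep x (sortOn-↭ xs))

    ∷-sorted : ∀ {e h t} → key e ≤ key h → Sorted (h ∷ t) → Sorted (e ∷ h ∷ t)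
    ∷-sorted e≤h sorted@(h≤t ∷ _) = (e≤h ∷ All.map (≤-trans e≤h) h≤t) ∷ sorted

    insertOn-sorted : ∀ e t → Sorted t → Sorted (insertOn e t)
    insertOn-sorted e []      []                   = [] ∷ []
    insertOn-sorted e (h ∷ t) sorted@(h≤t ∷ t-sorted) with compare (key h) (key e)
    ... | tri< h<e _ _ =
          All-resp-↭ (↭-sym (insertOn-↭ e t)) (<⇒≤ h<e ∷ h≤t) ∷ insertOn-sorted e t t-sorted
    ... | tri≈ h≮e _ _ = ∷-sorted (≮⇒≥ h≮e) sorted
    ... | tri> h≮e _ _ = ∷-sorted (≮⇒≥ h≮e) sorted

    sortOn-sorted : ∀ xs → Sorted (sortOn xs)
    sortOn-sorted []       = []
    sortOn-sorted (x ∷ xs) = insertOn-sorted x (sortOn xs) (sortOn-sorted xs)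

    Sorted-head : ∀ {x xs u} → Sorted (x ∷ xs) → u ∈ x ∷ xs → key x ≤ key u
    Sorted-head _           (here refl) = ≤-refl
    Sorted-head (x≤xs ∷ _)  (there u∈)  = All.lookup x≤xs u∈

  module _ {I : Set} (key : I → A) (side : I → Side) where
    open Word side

    private
      sideL≢sideR : ∀ {x} → side x ≡ sideL → side x ≡ sideR → ⊥
      sideL≢sideR sx sx′ with trans (sym sx) sx′
      ... | ()

    firstRight-least : ∀ {ys s u} → Sorted key ys → FirstRight ys s →
                       u ∈ ys → side u ≡ sideR → key u < key s → ⊥
    firstRight-least sorted       (here _)     u∈          _  u<s = <⇒≱ u<s (Sorted-head key sorted u∈)
    firstRight-least _            (there sx _) (here refl) su _   = sideL≢sideR sx su
    firstRight-least (_ ∷ sorted) (there _ fr) (there u∈)  su u<s = firstRight-least sorted fr u∈ su u<s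

    zpattern-ordered : ∀ {xs r q s} → Sorted key xs → ZPattern xs r q s →
                       key r ≤ key q × key q ≤ key s
    zpattern-ordered ((r≤q ∷ _) ∷ q≤ys ∷ _) (here _ _ fr) = r≤q , All.lookup q≤ys (firstRight-∈ fr)
    zpattern-ordered (_ ∷ sorted)           (there zp)    = zpattern-ordered sorted zp

    private
      ≰-pattern-r : ∀ {x xs r q s} → All (λ y → key x ≤ key y) xs → ZPattern xs r q s →
                    key r < key x → ⊥
      ≰-pattern-r x≤xs zp r<x = <⇒≱ r<x (All.lookup x≤xs (proj₁ (zpattern-∈ zp)))

    zpattern-adjacent : ∀ {xs r q s u} → Sorted key xs → ZPattern xs r q s →
                        u ∈ xs → key r < key u → key u < key q → ⊥
    zpattern-adjacent _            (here _ _ _) (here refl) r<u _   = irrefl Eq.refl r<u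
    zpattern-adjacent (_ ∷ sorted) (here _ _ _) (there u∈)  _   u<q = <⇒≱ u<q (Sorted-head key sorted u∈)
    zpattern-adjacent (x≤ ∷ _)     (there zp)   (here refl) r<u _   = ≰-pattern-r x≤ zp r<u
    zpattern-adjacent (_ ∷ sorted) (there zp)   (there u∈)  r<u u<q = zpattern-adjacent sorted zp u∈ r<u u<q

    zpattern-right-adjacent : ∀ {xs r q s u} → Sorted key xs → ZPattern xs r q s →
                              u ∈ xs → side u ≡ sideR → key r < key u → key u < key s → ⊥
    zpattern-right-adjacent _ (here _ _ _)  (here refl)         _  r<u _ = irrefl Eq.refl r<u
    zpattern-right-adjacent _ (here _ sq _) (there (here refl)) su _   _ = sideL≢sideR sq su
    zpattern-right-adjacent (_ ∷ _ ∷ sorted) (here _ _ fr) (there (there u∈)) su _ u<s =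
      firstRight-least sorted fr u∈ su u<s
    zpattern-right-adjacent (x≤ ∷ _) (there zp) (here refl) _ r<u _ = ≰-pattern-r x≤ zp r<u
    zpattern-right-adjacent (_ ∷ sorted) (there zp) (there u∈) su r<u u<s =
      zpattern-right-adjacent sorted zp u∈ su r<u u<s

AllPairs-lookup : ∀ {X : Set} {R : X → X → Set} → (∀ {x y} → R x y → R y x) →
                  ∀ {xs} → AllPairs R xs → ∀ {i j} → i ≢ j → R (lookup xs i) (lookup xs j)
AllPairs-lookup sym-R (_ ∷ _)     {zero}  {zero}  i≢j = ⊥-elim (i≢j refl)
AllPairs-lookup sym-R (Rx ∷ _)    {zero}  {suc j} _   = All.lookup Rx (∈-lookup j)
AllPairs-lookup sym-R (Rx ∷ _)    {suc i} {zero}  _   = sym-R (All.lookup Rx (∈-lookup i))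
AllPairs-lookup sym-R (_ ∷ pairs) {suc i} {suc j} i≢j = AllPairs-lookup sym-R pairs (i≢j ∘ cong suc)

module Points (O : StrictTotalOrder 0ℓ 0ℓ 0ℓ) (P : List (Point O)) where
  open Order O
  open Data.List.Extrema totalOrder using (argmax; argmax-all; f[xs]≤f[argmax])

  Idx : Set
  Idx = Fin (length P)

  X Y : Idx → A
  X i = proj₁ (lookup P i)
  Y i = proj₂ (lookup P i)

  Box : A → A → A → A → Idx → Set
  Box x₁ x₂ y₁ y₂ t = x₁ ≤ X t × X t ≤ x₂ × y₁ ≤ Y t × Y t ≤ y₂

  InRect : Idx → Idx → Idx → Set
  InRect p q t = Between (X p) (X q) (X t) × Between (Y p) (Y q) (Y t)

  EmptyRect : Idx → Idx → Set
  EmptyRect p q = ∀ t → InRect p q t → t ≡ p ⊎ t ≡ q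

  Below : Idx → Idx → Set
  Below p q = Y q < Y p × EmptyRect p q

  FL FR : Idx → Idx → Set
  FL p q = Below p q × X q < X p
  FR p q = Below p q × X p < X q

  IsZRect : Idx → Idx → Idx → Idx → Set
  IsZRect p q r s = X q < X p × X p < X r × X r < X s × Y r < Y q × Y q < Y s × Y s < Y p ×
                    (∀ t → Box (X q) (X s) (Y r) (Y p) t → t ≡ p ⊎ t ≡ q ⊎ t ≡ r ⊎ t ≡ s)

  T-between : ∀ {a b c} → T (between O P a b c) ⇔ Between a b c
  T-between = T-∨-⇔ (T-∧-⇔ T-leb T-leb) (T-∧-⇔ T-leb T-leb)

  T-inRect : ∀ {p q t} → T (inRect O P p q t) ⇔ InRect p q t
  T-inRect = T-∧-⇔ T-between T-between

  T-below-empty : ∀ {p q} → T (below-empty O P p q) ⇔ Below p q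
  T-below-empty = T-∧-⇔ T-ltb (T-allFin-⇔ λ _ → T-not-∨-⇔ T-inRect (T-∨-⇔ T-≟ T-≟))

  T-inFL : ∀ {p q} → T (inFL O P p q) ⇔ FL p q
  T-inFL = T-∧-⇔ T-below-empty T-ltb

  T-inFR : ∀ {p q} → T (inFR O P p q) ⇔ FR p q
  T-inFR = T-∧-⇔ T-below-empty T-ltb

  T-isZRect : ∀ {p q r s} → T (isZRect O P p q r s) ⇔ IsZRect p q r s
  T-isZRect = T-∧-⇔ T-ltb (T-∧-⇔ T-ltb (T-∧-⇔ T-ltb (T-∧-⇔ T-ltb (T-∧-⇔ T-ltb (T-∧-⇔ T-ltb
    (T-allFin-⇔ λ _ → T-not-∨-⇔ T-inBox (T-∨-⇔ T-≟ (T-∨-⇔ T-≟ (T-∨-⇔ T-≟ T-≟)))))))))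
    where
    T-inBox : ∀ {x₁ x₂ y₁ y₂ t} → T (inBox O P x₁ x₂ y₁ y₂ t) ⇔ Box x₁ x₂ y₁ y₂ t
    T-inBox = T-∧-⇔ T-leb (T-∧-⇔ T-leb (T-∧-⇔ T-leb T-leb))

  sortY-map : ∀ {I : Set} (key : I → A) (label : I → Side) xs →
              sortY O P (map (λ u → key u , label u) xs) ≡ map (λ u → key u , label u) (sortOn key xs)
  sortY-map key label []       = refl
  sortY-map key label (x ∷ xs) =
    trans (cong (insertY O P (key x , label x)) (sortY-map key label xs)) (insertY-map (sortOn key xs))
    where
    insertY-map : ∀ t → insertY O P (key x , label x) (map (λ u → key u , label u) t)
                        ≡ map (λ u → key u , label u) (insertOn key x t)
    insertY-map []      = refl
    insertY-map (h ∷ t) with ltb O (key h) (key x)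
    ... | true  = cong ((key h , label h) ∷_) (insertY-map t)
    ... | false = refl

  InRect-trans : ∀ {p t u w} → InRect p t u → InRect p u w → InRect p t w
  InRect-trans (xu , yu) (xw , yw) = Between-trans xu xw , Between-trans yu yw

  module Distinct (distinct : DistinctCoords O P) where

    private
      distinct-at : ∀ {i j} → i ≢ j → ¬ X i ≈ X j × ¬ Y i ≈ Y j
      distinct-at = AllPairs-lookup (λ (x≉ , y≉) → x≉ ∘ Eq.sym , y≉ ∘ Eq.sym) distinct

    X-injective : ∀ {i j} → X i ≈ X j → i ≡ j
    X-injective {i} {j} xi≈xj with i ≟ j
    ... | yes i≡j = i≡j
    ... | no  i≢j = ⊥-elim (proj₁ (distinct-at i≢j) xi≈xj)

    Y-injective : ∀ {i j} → Y i ≈ Y j → i ≡ j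
    Y-injective {i} {j} yi≈yj with i ≟ j
    ... | yes i≡j = i≡j
    ... | no  i≢j = ⊥-elim (proj₂ (distinct-at i≢j) yi≈yj)

    nearest-below : ∀ {p} t → Y t < Y p → Σ[ u ∈ Idx ] InRect p t u × Below p u
    nearest-below {p} t yt<yp = u , u∈rect , yu<yp , u-empty
      where
      Candidate : Idx → Set
      Candidate w = InRect p t w × Y w < Y p

      candidate? : ∀ w → Dec (Candidate w)
      candidate? w = Dec.map T-inRect (T? (inRect O P p t w)) ×-dec (Y w <? Y p)

      candidates : List Idx
      candidates = filter candidate? (allFin _)

      u : Idx
      u = argmax Y t candidates

      u-candidate : Candidate u
      u-candidate =
        argmax-all Y ((Between-end _ _ , Between-end _ _) , yt<yp) (all-filter candidate? (allFin _))

      u∈rect = proj₁ u-candidate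
      yu<yp = proj₂ u-candidate

      u-highest : ∀ {w} → Candidate w → Y w ≤ Y u
      u-highest {w} w-candidate = All.lookup (f[xs]≤f[argmax] {f = Y} t candidates)
                                             (∈-filter⁺ candidate? (∈-allFin w) w-candidate)

      u-empty : EmptyRect p u
      u-empty w w∈rect with Between-≥ (<⇒≤ yu<yp) (proj₂ w∈rect) | Y w <? Y p
      ... | _     , yw≤yp | no  yw≮yp = inj₁ (Y-injective (≤-antisym yw≤yp (≮⇒≥ yw≮yp)))
      ... | yu≤yw , _     | yes yw<yp =
            inj₂ (Y-injective (≤-antisym (u-highest (InRect-trans u∈rect w∈rect , yw<yp)) yu≤yw))

    ≤⇒<-X : ∀ {i j} → i ≢ j → X i ≤ X j → X i < X j
    ≤⇒<-X i≢j xi≤xj = ≤∧≉⇒< xi≤xj (i≢j ∘ X-injective)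

    ≤⇒<-Y : ∀ {i j} → i ≢ j → Y i ≤ Y j → Y i < Y j
    ≤⇒<-Y i≢j yi≤yj = ≤∧≉⇒< yi≤yj (i≢j ∘ Y-injective)

    only-corner : ∀ {p c r t} → Below p c →
                  (∀ u → Below p u → Between (X p) (X c) (X u) → Y r < Y u → Y u < Y c → ⊥) →
                  Between (X p) (X c) (X t) → Y r < Y t → Y t ≤ Y p → t ≡ p ⊎ t ≡ c
    only-corner {p} {c} {r} {t} (yc<yp , c-empty) no-between xt yr<yt yt≤yp with Y t <? Y c
    ... | no yt≮yc = c-empty t (xt , inj₂ (≮⇒≥ yt≮yc , yt≤yp))
    ... | yes yt<yc with nearest-below t (<-trans yt<yc yc<yp)
    ...   | u , (xu , yu) , below-u@(yu<yp , _)
          with Between-≥ (<⇒≤ (<-trans yt<yc yc<yp)) yu | Y u <? Y c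
    ...     | yt≤yu , _ | yes yu<yc =
              ⊥-elim (no-between u below-u (Between-trans xt xu) (<-≤-trans yr<yt yt≤yu) yu<yc)
    ...     | _ , yu≤yp | no yu≮yc with c-empty u (Between-trans xt xu , inj₂ (≮⇒≥ yu≮yc , yu≤yp))
    ...       | inj₁ refl = ⊥-elim (irrefl Eq.refl yu<yp)
    ...       | inj₂ refl = inj₂ (X-injective (Between-antisym xu xt))

    neighbours⇒IsZRect : ∀ {p q r s} → FL p q → FR p r → FR p s → Y r < Y q → Y q < Y s →
      (∀ u → Below p u → Between (X p) (X q) (X u) → Y r < Y u → Y u < Y q → ⊥) →
      (∀ u → Below p u → Between (X p) (X s) (X u) → Y r < Y u → Y u < Y s → ⊥) →
      IsZRect p q r s
    neighbours⇒IsZRect {p} {q} {r} {s}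
      (below-q , xq<xp) ((yr<yp , r-empty) , xp<xr) (below-s@(ys<yp , _) , xp<xs)
      yr<yq yq<ys no-left no-right =
      xq<xp , xp<xr , xr<xs , yr<yq , yq<ys , ys<yp , box-empty
      where
      yr<ys = <-trans yr<yq yq<ys

      xr<xs : X r < X s
      xr<xs with compare (X r) (X s)
      ... | tri< xr<xs _ _ = xr<xs
      ... | tri≈ _ xr≈xs _ = ⊥-elim (key<⇒≢ Y yr<ys (X-injective xr≈xs))
      ... | tri> _ _ xs<xr
          with r-empty s (inj₁ (<⇒≤ xp<xs , <⇒≤ xs<xr) , inj₂ (<⇒≤ yr<ys , <⇒≤ ys<yp))
      ...   | inj₁ s≡p = ⊥-elim (key<⇒≢ Y ys<yp s≡p)
      ...   | inj₂ s≡r = ⊥-elim (key<⇒≢ Y yr<ys (sym s≡r))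

      off-r : ∀ t → X q ≤ X t → X t ≤ X s → Y r < Y t → Y t ≤ Y p →
              t ≡ p ⊎ t ≡ q ⊎ t ≡ r ⊎ t ≡ s
      off-r t xq≤xt xt≤xs yr<yt yt≤yp with compare (X t) (X p)
      ... | tri< xt<xp _ _ =
            [ inj₁ , inj₂ ∘ inj₁ ]′
              (only-corner below-q no-left (inj₂ (xq≤xt , <⇒≤ xt<xp)) yr<yt yt≤yp)
      ... | tri≈ _ xt≈xp _ = inj₁ (X-injective xt≈xp)
      ... | tri> _ _ xp<xt =
            [ inj₁ , inj₂ ∘ inj₂ ∘ inj₂ ]′
              (only-corner below-s no-right (inj₁ (<⇒≤ xp<xt , xt≤xs)) yr<yt yt≤yp)

      box-empty : ∀ t → Box (X q) (X s) (Y r) (Y p) t → t ≡ p ⊎ t ≡ q ⊎ t ≡ r ⊎ t ≡ s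
      box-empty t (xq≤xt , xt≤xs , yr≤yt , yt≤yp) with t ≟ r
      ... | yes t≡r = inj₂ (inj₂ (inj₁ t≡r))
      ... | no  t≢r = off-r t xq≤xt xt≤xs (≤⇒<-Y (t≢r ∘ sym) yr≤yt) yt≤yp

-- Imported only now: the modules above use the carrier order's _≤_.
open import Data.Nat using (ℕ; suc; _+_; _*_; _≤_; z≤n; s≤s)
open import Data.Nat.Properties
  using (≤-refl; ≤-reflexive; ≤-trans; +-suc; m≤n+m; m≤m+n; +-monoˡ-≤; +-monoʳ-≤; +-mono-≤;
         *-monoˡ-≤; *-monoʳ-≤; *-assoc; n≤1+n; module ≤-Reasoning)
open import Data.Nat.Tactic.RingSolver using (solve-∀)
open import Data.Nat.ListAction using (sum)
open import Data.Nat.ListAction.Properties using (sum-↭)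

m≤2n+k⇒m≤2[g+n]+k : ∀ {m n k} g → m ≤ 2 * n + k → m ≤ 2 * (g + n) + k
m≤2n+k⇒m≤2[g+n]+k {n = n} {k} g m≤ = ≤-trans m≤ (+-monoˡ-≤ k (*-monoʳ-≤ 2 (m≤n+m n g)))

m≤n+k⇒1+m≤n+[1+k] : ∀ {m n k} → m ≤ n + k → suc m ≤ n + suc k
m≤n+k⇒1+m≤n+[1+k] {n = n} {k} m≤ = ≤-trans (s≤s m≤) (≤-reflexive (sym (+-suc n k)))

m≤2n+2⇒1+m≤2[g+n]+1 : ∀ {m n g} → 1 ≤ g → m ≤ 2 * n + 2 → suc m ≤ 2 * (g + n) + 1
m≤2n+2⇒1+m≤2[g+n]+1 {n = n} 1≤g m≤ =
  ≤-trans (s≤s m≤) (≤-trans (≤-reflexive (regroup n)) (+-monoˡ-≤ 1 (*-monoʳ-≤ 2 (+-monoˡ-≤ n 1≤g))))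
  where
  regroup : ∀ n → suc (2 * n + 2) ≡ 2 * (1 + n) + 1
  regroup = solve-∀

term≤sum : ∀ {I : Set} (g : I → ℕ) {xs i} → i ∈ xs → g i ≤ sum (map g xs)
term≤sum g             (here refl) = m≤m+n _ _
term≤sum g {x ∷ _}     (there i∈)  = ≤-trans (term≤sum g i∈) (m≤n+m _ (g x))

sum-filter-≤ : ∀ {I : Set} {Q : I → Set} (Q? : Decidable Q) (g : I → ℕ) xs →
               sum (map g (filter Q? xs)) ≤ sum (map g xs)
sum-filter-≤ Q? g []       = z≤n
sum-filter-≤ Q? g (x ∷ xs) with does (Q? x)
... | true  = +-monoʳ-≤ (g x) (sum-filter-≤ Q? g xs)
... | false = ≤-trans (sum-filter-≤ Q? g xs) (m≤n+m _ (g x))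

sum-≤-affine : ∀ {I : Set} (g h : I → ℕ) a c → (∀ i → g i ≤ a * h i + c) →
               ∀ xs → sum (map g xs) ≤ a * sum (map h xs) + c * length xs
sum-≤-affine g h a c g≤ []       = z≤n
sum-≤-affine g h a c g≤ (x ∷ xs) = begin
  g x + sum (map g xs)                               ≤⟨ +-mono-≤ (g≤ x) (sum-≤-affine g h a c g≤ xs) ⟩
  a * h x + c + (a * sum (map h xs) + c * length xs) ≡⟨ regroup a c (h x) (sum (map h xs)) (length xs) ⟩
  a * (h x + sum (map h xs)) + c * suc (length xs)   ∎
  where
  open ≤-Reasoning
  regroup : ∀ a c k s n → a * k + c + (a * s + c * n) ≡ a * (k + s) + c * (1 + n)
  regroup = solve-∀

1≤countFin : ∀ {n} (g : Fin n → Bool) {i} → T (g i) → 1 ≤ countFin n g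
1≤countFin g {i} gi with g i | term≤sum (λ j → if g j then 1 else 0) (∈-allFin i)
... | true | one≤count = one≤count

module _ {I : Set} (side : I → Side) where
  open Word side

  -- After a letter a, at most slack a changes of the rest of the word are paid for by no ZPattern:
  -- a final L→R→L after an L, a final R→L after an R.
  slack : Side → ℕ
  slack sideL = 2
  slack sideR = 1

  slack≤2 : ∀ a → slack a ≤ 2
  slack≤2 sideL = ≤-refl
  slack≤2 sideR = s≤s z≤n

  changes-≤ : (weight : I → ℕ) → ∀ a xs →
              (∀ {r q s} → ZPattern (a ∷ xs) r q s → 1 ≤ weight q) →
              changes (side a) (map side xs) ≤ 2 * sum (map weight xs) + slack (side a)
  changes-≤ weight a []       _   = z≤n
  changes-≤ weight a (b ∷ xs) pos
    with side a in sa | side b in sb | changes-≤ weight b xs (pos ∘ there)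
  ... | sideL | sideL | ih = m≤2n+k⇒m≤2[g+n]+k (weight b) ih
  ... | sideL | sideR | ih = m≤2n+k⇒m≤2[g+n]+k (weight b) (m≤n+k⇒1+m≤n+[1+k] ih)
  ... | sideR | sideR | ih = m≤2n+k⇒m≤2[g+n]+k (weight b) ih
  ... | sideR | sideL | ih with firstRight? xs
  ...   | inj₁ allLeft rewrite changes-allLeft allLeft = m≤n+m 1 _
  ...   | inj₂ (s , fr) = m≤2n+2⇒1+m≤2[g+n]+1 (pos (here sa sb fr)) ih

  blocks-≤ : (weight : I → ℕ) → ∀ xs → (∀ {r q s} → ZPattern xs r q s → 1 ≤ weight q) →
             blocks (map side xs) ≤ 2 * sum (map weight xs) + 3
  blocks-≤ weight []       _   = z≤n
  blocks-≤ weight (a ∷ xs) pos =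
    m≤2n+k⇒m≤2[g+n]+k (weight a) (m≤n+k⇒1+m≤n+[1+k] (≤-trans (changes-≤ weight a xs pos)
                                                               (+-monoʳ-≤ _ (slack≤2 (side a)))))

sideOf : Bool → Side
sideOf true  = sideL
sideOf false = sideR

sideOf-sideL : ∀ {b} → sideOf b ≡ sideL → T b
sideOf-sideL {true} _ = _

sideOf-sideR : ∀ {b} → sideOf b ≡ sideR → ¬ T b
sideOf-sideR {false} _ ()

¬T⇒sideOf-sideR : ∀ {b} → ¬ T b → sideOf b ≡ sideR
¬T⇒sideOf-sideR {true}  ¬b = ⊥-elim (¬b _)
¬T⇒sideOf-sideR {false} _  = refl

module Apex (O : StrictTotalOrder 0ℓ 0ℓ 0ℓ) (P : List (Point O)) (distinct : DistinctCoords O P)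
            (p : Points.Idx O P) where
  open Order O
    using (_<_; <-trans; asym; <⇒≤; key<⇒≢; Between; Between-≤; Between-≥; sortOn; sortOn-↭; sortOn-sorted;
           zpattern-ordered; zpattern-adjacent; zpattern-right-adjacent)
  open Points O P
  open Distinct distinct

  side : Idx → Side
  side u = sideOf (inFL O P p u)

  isNeighbour : Idx → Bool
  isNeighbour u = inFL O P p u ∨ inFR O P p u

  neighbours : List Idx
  neighbours = filter (T? ∘ isNeighbour) (allFin _)

  sortedNeighbours : List Idx
  sortedNeighbours = sortOn Y neighbours

  labelled-≡ : ∀ xs →
    concatMap (λ q → (if inFL O P p q then (Y q , sideL) ∷ [] else [])
                     ++ (if inFR O P p q then (Y q , sideR) ∷ [] else [])) xs
    ≡ map (λ u → Y u , side u) (filter (T? ∘ isNeighbour) xs)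
  labelled-≡ []       = refl
  labelled-≡ (x ∷ xs) with inFL O P p x in inL | inFR O P p x in inR
  ... | true  | true  =
        ⊥-elim (asym (proj₂ (to T-inFL (from T-≡ inL))) (proj₂ (to T-inFR (from T-≡ inR))))
  ... | true  | false = cong₂ _∷_ (cong (Y x ,_) (cong sideOf (sym inL))) (labelled-≡ xs)
  ... | false | true  = cong₂ _∷_ (cong (Y x ,_) (cong sideOf (sym inL))) (labelled-≡ xs)
  ... | false | false = labelled-≡ xs

  mix-≡ : mix O P p ≡ map side sortedNeighbours
  mix-≡ = begin
    map proj₂ (sortY O P (labelled O P p))
      ≡⟨ cong (map proj₂ ∘ sortY O P) (labelled-≡ (allFin _)) ⟩
    map proj₂ (sortY O P (map (λ u → Y u , side u) neighbours))
      ≡⟨ cong (map proj₂) (sortY-map Y side neighbours) ⟩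
    map proj₂ (map (λ u → Y u , side u) sortedNeighbours)
      ≡⟨ sym (map-∘ sortedNeighbours) ⟩
    map side sortedNeighbours
      ∎
    where open ≡-Reasoning

  private
    sorted-∈⁻ : ∀ {u} → u ∈ sortedNeighbours → T (isNeighbour u)
    sorted-∈⁻ u∈ =
      proj₂ (∈-filter⁻ (T? ∘ isNeighbour) {xs = allFin _} (∈-resp-↭ (sortOn-↭ Y neighbours) u∈))

    sorted-∈⁺ : ∀ {u} → T (isNeighbour u) → u ∈ sortedNeighbours
    sorted-∈⁺ nb =
      ∈-resp-↭ (↭-sym (sortOn-↭ Y neighbours)) (∈-filter⁺ (T? ∘ isNeighbour) (∈-allFin _) nb)

  sideL⇒FL : ∀ {u} → side u ≡ sideL → FL p u
  sideL⇒FL su = to T-inFL (sideOf-sideL su)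

  sideR⇒FR : ∀ {u} → u ∈ sortedNeighbours → side u ≡ sideR → FR p u
  sideR⇒FR u∈ su with to T-∨ (sorted-∈⁻ u∈)
  ... | inj₁ inL = ⊥-elim (sideOf-sideR su inL)
  ... | inj₂ inR = to T-inFR inR

  FL⇒∈ : ∀ {u} → FL p u → u ∈ sortedNeighbours
  FL⇒∈ fl = sorted-∈⁺ (from T-∨ (inj₁ (from T-inFL fl)))

  FR⇒∈ : ∀ {u} → FR p u → u ∈ sortedNeighbours × side u ≡ sideR
  FR⇒∈ fr@(_ , xp<xu) =
    sorted-∈⁺ (from T-∨ (inj₂ (from T-inFR fr))) ,
    ¬T⇒sideOf-sideR (λ inL → asym (proj₂ (to T-inFL inL)) xp<xu)

  open Word side

  zpattern⇒IsZRect : ∀ {r q s} → ZPattern sortedNeighbours r q s → IsZRect p q r s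
  zpattern⇒IsZRect {r} {q} {s} zp =
    neighbours⇒IsZRect fl-q fr-r fr-s (≤⇒<-Y r≢q yr≤yq) (≤⇒<-Y q≢s yq≤ys) no-left no-right
    where
    sorted = sortOn-sorted Y neighbours
    fl-q = sideL⇒FL (proj₁ (proj₂ (zpattern-sides zp)))
    fr-r = sideR⇒FR (proj₁ (zpattern-∈ zp)) (proj₁ (zpattern-sides zp))
    fr-s = sideR⇒FR (proj₂ (proj₂ (zpattern-∈ zp))) (proj₂ (proj₂ (zpattern-sides zp)))
    xq<xp = proj₂ fl-q
    yr≤yq = proj₁ (zpattern-ordered Y side sorted zp)
    yq≤ys = proj₂ (zpattern-ordered Y side sorted zp)
    r≢q = ≢-sym (key<⇒≢ X (<-trans xq<xp (proj₂ fr-r)))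
    q≢s = key<⇒≢ X (<-trans xq<xp (proj₂ fr-s))

    no-left : ∀ u → Below p u → Between (X p) (X q) (X u) → Y r < Y u → Y u < Y q → ⊥
    no-left u below-u xu = zpattern-adjacent Y side sorted zp (FL⇒∈ (below-u , xu<xp))
      where
      xu<xp = ≤⇒<-X (key<⇒≢ Y (proj₁ below-u)) (proj₂ (Between-≥ (<⇒≤ xq<xp) xu))

    no-right : ∀ u → Below p u → Between (X p) (X s) (X u) → Y r < Y u → Y u < Y s → ⊥
    no-right u below-u xu = zpattern-right-adjacent Y side sorted zp (proj₁ fr-u) (proj₂ fr-u)
      where
      xp<xu = ≤⇒<-X (≢-sym (key<⇒≢ Y (proj₁ below-u))) (proj₁ (Between-≤ (<⇒≤ (proj₂ fr-s)) xu))
      fr-u = FR⇒∈ (below-u , xp<xu)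

  zRectsWith : Idx → ℕ
  zRectsWith q = sumFin _ λ r → countFin _ λ s → isZRect O P p q r s

  f-≤ : f O P p ≤ 2 * sumFin _ zRectsWith + 3
  f-≤ = begin
    f O P p
      ≡⟨ cong blocks mix-≡ ⟩
    blocks (map side sortedNeighbours)
      ≤⟨ blocks-≤ side zRectsWith sortedNeighbours zpattern-counted ⟩
    2 * sum (map zRectsWith sortedNeighbours) + 3
      ≡⟨ cong (λ n → 2 * n + 3) (sum-↭ (map⁺ zRectsWith (sortOn-↭ Y neighbours))) ⟩
    2 * sum (map zRectsWith neighbours) + 3
      ≤⟨ +-monoˡ-≤ 3 (*-monoʳ-≤ 2 (sum-filter-≤ (T? ∘ isNeighbour) zRectsWith (allFin _))) ⟩
    2 * sumFin _ zRectsWith + 3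
      ∎
    where
    open ≤-Reasoning
    zpattern-counted : ∀ {r q s} → ZPattern sortedNeighbours r q s → 1 ≤ zRectsWith q
    zpattern-counted {r} {q} {s} zp =
      ≤-trans (1≤countFin (isZRect O P p q r) (from T-isZRect (zpattern⇒IsZRect zp)))
              (term≤sum (λ r′ → countFin _ (isZRect O P p q r′)) (∈-allFin r))

funnel-≤ : ∀ O (P : List (Point O)) → DistinctCoords O P →
           Funnel O P ≤ 2 * zRects O P + 3 * length P
funnel-≤ O P distinct =
  subst (λ n → Funnel O P ≤ 2 * zRects O P + 3 * n) (length-tabulate {n = length P} id)
    (sum-≤-affine (f O P) (λ p → sumFin _ (Apex.zRectsWith O P distinct p)) 2 3
                  (Apex.f-≤ O P distinct) (allFin _))

lemma21 : Σ ℕ (λ C → (O : StrictTotalOrder 0ℓ 0ℓ 0ℓ) → (P : List (Point O)) →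
            DistinctCoords O P →
            Funnel O P ≤ 2 * zRects O P + 2 * (C * length P))
lemma21 = 2 , λ O P distinct →
  ≤-trans (funnel-≤ O P distinct) (+-monoʳ-≤ (2 * zRects O P) (3m≤2[2m] (length P)))
  where
  3m≤2[2m] : ∀ m → 3 * m ≤ 2 * (2 * m)
  3m≤2[2m] m = ≤-trans (*-monoˡ-≤ m (n≤1+n 3)) (≤-reflexive (*-assoc 2 2 m))
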